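{- Let $\Box$ denote the QS4 modal operator, and let $A\mapsto A_\Box$ be the $\Box$-interpretation of QHC in QS4, defined recursively as follows. Fix an injective assignment $\alpha\mapsto\hat\alpha$ of a predicate variable of QS4 of the same arity to each problem variable, disjoint from the proper predicate variables, which are kept as they are. Then: $(p(x_1,\dots,x_n))_\Box=p(x_1,\dots,x_n)$; $\top_\Box=\top$, $\bot_\Box=\bot$; classical connectives and quantifiers are preserved, e.g. $(F\to G)_\Box=F_\Box\to G_\Box$ and $(\forall x\,F)_\Box=\forall x\,F_\Box$; $(?\Phi)_\Box=\Phi_\Box$; $(\alpha(x_1,\dots,x_n))_\Box=\Box\hat\alpha(x_1,\dots,x_n)$; $\checkmark_\Box=\top$, $\curlywedge_\Box=\bot$; for each intuitionistic binary connective $\circ\in\{\land,\lor,\to,\leftrightarrow\}$, $(\Phi\circ\Psi)_\Box=\Box(\Phi_\Box\circ\Psi_\Box)$ with $\circ$ now classical; $(\neg\Phi)_\Box=\Box\neg\Phi_\Box$; $(\exists x\,\Phi)_\Box=\Box\exists x\,\Phi_\Box$ and $(\forall x\,\Phi)_\Box=\Box\forall x\,\Phi_\Box$; and $(!F)_\Box=\Box F_\Box$. If $A_1,\dots,A_n,A$ are formulas of QHC with $A_1,\dots,A_n\vdash_{QHC}A$, then $(A_1)_\Box,\dots,(A_n)_\Box\vdash_{QS4}A_\Box$.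
   Context: Meta-logical framework. Formulas of a first-order language may contain individual variables and predicate variables. Meta-formulas are built from formulas using meta-conjunction $\&$, meta-implication $\Rightarrow$, and universal meta-quantifiers over individual and predicate variables. A principle $\cdot G$, for a formula $G$, is the meta-formula obtained by universally meta-quantifying all free individual variables of $G$ and then all predicate variables of $G$. A rule $F_1,\dots,F_m/G$ is the meta-formula $\forall^2(\forall^1F_1\,\&\cdots\&\,\forall^1F_m\Rightarrow\forall^1G)$, where $\forall^1$ meta-quantifies the free individual variables of the formula it precedes and $\forall^2$ meta-quantifies all predicate variables occurring. A logic $L$ is given by a derivation system $\mathcal D$, a meta-conjunction of finitely many principles and rules. For a meta-formula $\mathcal F$, $\vdash_L\mathcal F$ means that $\mathcal D\Rightarrow\mathcal F$ is derivable by the natural-deduction meta-rules: introduction and elimination of $\&$, $\Rightarrow$ and the universal meta-quantifiers (elimination allows substituting terms for individual variables and formulas for predicate variables), plus $\alpha$-conversion. The notation $\mathcal F_1,\dots,\mathcal F_m\vdash_L\mathcal G$ means $\vdash_L(\mathcal F_1\&\cdots\&\mathcal F_m)\Rightarrow\mathcal G$. A formula by itself is a meta-formula, with its free variables not generalized. Language of QHC. It has individual variables $x,y,\dots$ and, for each $n\ge0$, countably many $n$-ary problem variables $\alpha,\beta,\gamma,\delta,\theta,\dots$ and countably many $n$-ary proper predicate variables $p,q,\dots$. Formulas come in two sorts. - A c-formula is $\top$, $\bot$, an atom $p(x_1,\dots,x_n)$, or $?\Phi$ for an i-formula $\Phi$, closed under the classical connectives $\land,\lor,\to,\leftrightarrow,\neg$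 and quantifiers $\exists,\forall$. - An i-formula is $\checkmark$ (triviality), $\curlywedge$ (absurdity), an atom $\alpha(x_1,\dots,x_n)$, or $!F$ for a c-formula $F$, closed under the intuitionistic connectives $\land,\lor,\to,\leftrightarrow,\neg$ (with $\neg\Phi:=\Phi\to\curlywedge$) and quantifiers $\exists,\forall$. Classical and intuitionistic connectives are written alike; connectives applied to c-formulas are classical, and those applied to i-formulas are intuitionistic. QHC is the logic whose derivation system consists of: - (0a) all laws and rules of classical predicate logic QC, for c-formulas; - (0b) all laws and rules of intuitionistic predicate logic QH, for i-formulas; - the principles $\cdot\,?(\gamma\land\delta)\leftrightarrow ?\gamma\land ?\delta$, $\cdot\,?(\gamma\lor\delta)\leftrightarrow ?\gamma\lor ?\delta$, $\cdot\,?(\gamma\to\delta)\to(?\gamma\to ?\delta)$, $\cdot\,\neg ?\curlywedge$, $\cdot\,?\exists x\,\theta(x)\leftrightarrow\exists x\,?\theta(x)$, $\cdot\,?\forall x\,\theta(x)\to\forall x\,?\theta(x)$, $\cdot\,\gamma\to\,!?\gamma$, $\cdot\,\neg !\bot$, $\cdot\,?!p\to p$, $\cdot\,!p\to\,!?!p$ and $\cdot\,!(p\to q)\to(!p\to !q)$; - the rules $!p/p$ and $p/!p$. QS4 is the extension of QC by a unary modal operator $\Box$ with the laws $\cdot\,\Box p\to p$, $\cdot\,\Box p\to\Box\Box p$ and $\cdot\,\Box(p\to q)\to(\Box p\to\Box q)$, and the rule $p/\Box p$. -}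

module Defs where

open import Data.Nat using (ℕ; zero; suc)
open import Data.Sum using (_⊎_; inj₁; inj₂)
open import Relation.Binary.PropositionalEquality using (_≡_)
open import Data.Vec using (Vec)
import Data.Vec as Vec
open import Data.List using (List; map)
open import Data.List.Membership.Propositional using (_∈_)

-- Individual variables: de Bruijn indices (ℕ).  Terms are variables
-- only.

liftR : (ℕ → ℕ) → ℕ → ℕ
liftR ρ zero    = zero
liftR ρ (suc i) = suc (ρ i)

inst₀ : ℕ → ℕ → ℕ
inst₀ t zero    = t
inst₀ t (suc i) = i

mutual
  data CForm : Set where
    ctop cbot : CForm
    cpred     : (k i : ℕ) → Vec ℕ k → CForm
    cq        : IForm → CForm
    cand cor cimp ciff : CForm → CForm → CForm
    cneg      : CForm → CForm
    cex call  : CForm → CForm                    -- binds de Bruijn 0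

  data IForm : Set where
    itriv iabs : IForm
    iprob      : (k i : ℕ) → Vec ℕ k → IForm
    ibang      : CForm → IForm
    iand ior iimp iiff : IForm → IForm → IForm
    ineg       : IForm → IForm
    iex iall   : IForm → IForm

mutual
  renC : (ℕ → ℕ) → CForm → CForm
  renC ρ ctop = ctop
  renC ρ cbot = cbot
  renC ρ (cpred k i xs) = cpred k i (Vec.map ρ xs)
  renC ρ (cq Φ) = cq (renI ρ Φ)
  renC ρ (cand A B) = cand (renC ρ A) (renC ρ B)
  renC ρ (cor A B) = cor (renC ρ A) (renC ρ B)
  renC ρ (cimp A B) = cimp (renC ρ A) (renC ρ B)
  renC ρ (ciff A B) = ciff (renC ρ A) (renC ρ B)
  renC ρ (cneg A) = cneg (renC ρ A)
  renC ρ (cex A) = cex (renC (liftR ρ) A)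
  renC ρ (call A) = call (renC (liftR ρ) A)

  renI : (ℕ → ℕ) → IForm → IForm
  renI ρ itriv = itriv
  renI ρ iabs = iabs
  renI ρ (iprob k i xs) = iprob k i (Vec.map ρ xs)
  renI ρ (ibang F) = ibang (renC ρ F)
  renI ρ (iand A B) = iand (renI ρ A) (renI ρ B)
  renI ρ (ior A B) = ior (renI ρ A) (renI ρ B)
  renI ρ (iimp A B) = iimp (renI ρ A) (renI ρ B)
  renI ρ (iiff A B) = iiff (renI ρ A) (renI ρ B)
  renI ρ (ineg A) = ineg (renI ρ A)
  renI ρ (iex A) = iex (renI (liftR ρ) A)
  renI ρ (iall A) = iall (renI (liftR ρ) A)

Fm : Set
Fm = CForm ⊎ IForm

renF : (ℕ → ℕ) → Fm → Fm
renF ρ (inj₁ F) = inj₁ (renC ρ F)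
renF ρ (inj₂ Φ) = inj₂ (renI ρ Φ)

data CAx : CForm → Set where
  k-ax   : ∀ A B → CAx (cimp A (cimp B A))
  s-ax   : ∀ A B C → CAx (cimp (cimp A (cimp B C)) (cimp (cimp A B) (cimp A C)))
  andI   : ∀ A B → CAx (cimp A (cimp B (cand A B)))
  andE₁  : ∀ A B → CAx (cimp (cand A B) A)
  andE₂  : ∀ A B → CAx (cimp (cand A B) B)
  orI₁   : ∀ A B → CAx (cimp A (cor A B))
  orI₂   : ∀ A B → CAx (cimp B (cor A B))
  orE    : ∀ A B C → CAx (cimp (cimp A C) (cimp (cimp B C) (cimp (cor A B) C)))
  botE   : ∀ A → CAx (cimp cbot A)
  topI   : CAx ctop
  iffE₁  : ∀ A B → CAx (cimp (ciff A B) (cimp A B))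
  iffE₂  : ∀ A B → CAx (cimp (ciff A B) (cimp B A))
  iffI   : ∀ A B → CAx (cimp (cimp A B) (cimp (cimp B A) (ciff A B)))
  negE   : ∀ A → CAx (cimp (cneg A) (cimp A cbot))
  negI   : ∀ A → CAx (cimp (cimp A cbot) (cneg A))
  dne    : ∀ A → CAx (cimp (cneg (cneg A)) A)
  allE   : ∀ A t → CAx (cimp (call A) (renC (inst₀ t) A))
  exI    : ∀ A t → CAx (cimp (renC (inst₀ t) A) (cex A))
  allI   : ∀ B A → CAx (cimp (call (cimp (renC suc B) A)) (cimp B (call A)))
  exE    : ∀ A B → CAx (cimp (call (cimp A (renC suc B))) (cimp (cex A) B))

data IAx : IForm → Set where
  k-ax   : ∀ A B → IAx (iimp A (iimp B A))
  s-ax   : ∀ A B C → IAx (iimp (iimp A (iimp B C)) (iimp (iimp A B) (iimp A C)))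
  andI   : ∀ A B → IAx (iimp A (iimp B (iand A B)))
  andE₁  : ∀ A B → IAx (iimp (iand A B) A)
  andE₂  : ∀ A B → IAx (iimp (iand A B) B)
  orI₁   : ∀ A B → IAx (iimp A (ior A B))
  orI₂   : ∀ A B → IAx (iimp B (ior A B))
  orE    : ∀ A B C → IAx (iimp (iimp A C) (iimp (iimp B C) (iimp (ior A B) C)))
  botE   : ∀ A → IAx (iimp iabs A)
  topI   : IAx itriv
  iffE₁  : ∀ A B → IAx (iimp (iiff A B) (iimp A B))
  iffE₂  : ∀ A B → IAx (iimp (iiff A B) (iimp B A))
  iffI   : ∀ A B → IAx (iimp (iimp A B) (iimp (iimp B A) (iiff A B)))
  negE   : ∀ A → IAx (iimp (ineg A) (iimp A iabs))
  negI   : ∀ A → IAx (iimp (iimp A iabs) (ineg A))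
  allE   : ∀ A t → IAx (iimp (iall A) (renI (inst₀ t) A))
  exI    : ∀ A t → IAx (iimp (renI (inst₀ t) A) (iex A))
  allI   : ∀ B A → IAx (iimp (iall (iimp (renI suc B) A)) (iimp B (iall A)))
  exE    : ∀ A B → IAx (iimp (iall (iimp A (renI suc B))) (iimp (iex A) B))

data HCAx : CForm → Set where
  q-and  : ∀ γ δ → HCAx (ciff (cq (iand γ δ)) (cand (cq γ) (cq δ)))
  q-or   : ∀ γ δ → HCAx (ciff (cq (ior γ δ)) (cor (cq γ) (cq δ)))
  q-imp  : ∀ γ δ → HCAx (cimp (cq (iimp γ δ)) (cimp (cq γ) (cq δ)))
  q-abs  : HCAx (cneg (cq iabs))
  q-ex   : ∀ θ → HCAx (ciff (cq (iex θ)) (cex (cq θ)))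
  q-all  : ∀ θ → HCAx (cimp (cq (iall θ)) (call (cq θ)))
  q-bang : ∀ p → HCAx (cimp (cq (ibang p)) p)

data HIAx : IForm → Set where
  unit     : ∀ γ → HIAx (iimp γ (ibang (cq γ)))
  bang-bot : HIAx (ineg (ibang cbot))
  bang-4   : ∀ p → HIAx (iimp (ibang p) (ibang (cq (ibang p))))
  bang-K   : ∀ p q → HIAx (iimp (ibang (cimp p q)) (iimp (ibang p) (ibang q)))

-- Free variables of hypotheses are
-- not generalized: generalization is only allowed when the bound variable
-- is fresh for the hypotheses (hypotheses are shifted).  The rules
-- !p/p, p/!p (and MP) apply to any derived formula.
data _⊢QHC_ : List Fm → Fm → Set where
  hyp    : ∀ {Γ A} → A ∈ Γ → Γ ⊢QHC A
  cax    : ∀ {Γ F} → CAx F → Γ ⊢QHC inj₁ F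
  iax    : ∀ {Γ Φ} → IAx Φ → Γ ⊢QHC inj₂ Φ
  hcax   : ∀ {Γ F} → HCAx F → Γ ⊢QHC inj₁ F
  hiax   : ∀ {Γ Φ} → HIAx Φ → Γ ⊢QHC inj₂ Φ
  cmp    : ∀ {Γ F G} → Γ ⊢QHC inj₁ (cimp F G) → Γ ⊢QHC inj₁ F → Γ ⊢QHC inj₁ G
  imp    : ∀ {Γ Φ Ψ} → Γ ⊢QHC inj₂ (iimp Φ Ψ) → Γ ⊢QHC inj₂ Φ → Γ ⊢QHC inj₂ Ψ
  cgen   : ∀ {Γ F} → map (renF suc) Γ ⊢QHC inj₁ F → Γ ⊢QHC inj₁ (call F)
  igen   : ∀ {Γ Φ} → map (renF suc) Γ ⊢QHC inj₂ Φ → Γ ⊢QHC inj₂ (iall Φ)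
  bangE  : ∀ {Γ F} → Γ ⊢QHC inj₂ (ibang F) → Γ ⊢QHC inj₁ F
  bangI  : ∀ {Γ F} → Γ ⊢QHC inj₁ F → Γ ⊢QHC inj₂ (ibang F)

-- Language of QS4: predicate variables of arity k are named by ℕ ⊎ ℕ;
-- inj₁ i is the proper predicate variable p^k_i of QHC (kept as is),
-- inj₂ j are further predicate variables (used for the α̂).

data MForm : Set where
  mtop mbot : MForm
  mpred     : (k : ℕ) → ℕ ⊎ ℕ → Vec ℕ k → MForm
  mand mor mimp miff : MForm → MForm → MForm
  mneg      : MForm → MForm
  mex mall  : MForm → MForm
  mbox      : MForm → MForm

renM : (ℕ → ℕ) → MForm → MForm
renM ρ mtop = mtop
renM ρ mbot = mbot
renM ρ (mpred k v xs) = mpred k v (Vec.map ρ xs)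
renM ρ (mand A B) = mand (renM ρ A) (renM ρ B)
renM ρ (mor A B) = mor (renM ρ A) (renM ρ B)
renM ρ (mimp A B) = mimp (renM ρ A) (renM ρ B)
renM ρ (miff A B) = miff (renM ρ A) (renM ρ B)
renM ρ (mneg A) = mneg (renM ρ A)
renM ρ (mex A) = mex (renM (liftR ρ) A)
renM ρ (mall A) = mall (renM (liftR ρ) A)
renM ρ (mbox A) = mbox (renM ρ A)

data MAx : MForm → Set where
  k-ax   : ∀ A B → MAx (mimp A (mimp B A))
  s-ax   : ∀ A B C → MAx (mimp (mimp A (mimp B C)) (mimp (mimp A B) (mimp A C)))
  andI   : ∀ A B → MAx (mimp A (mimp B (mand A B)))
  andE₁  : ∀ A B → MAx (mimp (mand A B) A)
  andE₂  : ∀ A B → MAx (mimp (mand A B) B)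
  orI₁   : ∀ A B → MAx (mimp A (mor A B))
  orI₂   : ∀ A B → MAx (mimp B (mor A B))
  orE    : ∀ A B C → MAx (mimp (mimp A C) (mimp (mimp B C) (mimp (mor A B) C)))
  botE   : ∀ A → MAx (mimp mbot A)
  topI   : MAx mtop
  iffE₁  : ∀ A B → MAx (mimp (miff A B) (mimp A B))
  iffE₂  : ∀ A B → MAx (mimp (miff A B) (mimp B A))
  iffI   : ∀ A B → MAx (mimp (mimp A B) (mimp (mimp B A) (miff A B)))
  negE   : ∀ A → MAx (mimp (mneg A) (mimp A mbot))
  negI   : ∀ A → MAx (mimp (mimp A mbot) (mneg A))
  dne    : ∀ A → MAx (mimp (mneg (mneg A)) A)
  allE   : ∀ A t → MAx (mimp (mall A) (renM (inst₀ t) A))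
  exI    : ∀ A t → MAx (mimp (renM (inst₀ t) A) (mex A))
  allI   : ∀ B A → MAx (mimp (mall (mimp (renM suc B) A)) (mimp B (mall A)))
  exE    : ∀ A B → MAx (mimp (mall (mimp A (renM suc B))) (mimp (mex A) B))
  box-T  : ∀ p → MAx (mimp (mbox p) p)
  box-4  : ∀ p → MAx (mimp (mbox p) (mbox (mbox p)))
  box-K  : ∀ p q → MAx (mimp (mbox (mimp p q)) (mimp (mbox p) (mbox q)))

data _⊢QS4_ : List MForm → MForm → Set where
  hyp  : ∀ {Γ A} → A ∈ Γ → Γ ⊢QS4 A
  ax   : ∀ {Γ A} → MAx A → Γ ⊢QS4 A
  mp   : ∀ {Γ A B} → Γ ⊢QS4 mimp A B → Γ ⊢QS4 A → Γ ⊢QS4 B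
  gen  : ∀ {Γ A} → map (renM suc) Γ ⊢QS4 A → Γ ⊢QS4 mall A
  nec  : ∀ {Γ A} → Γ ⊢QS4 A → Γ ⊢QS4 mbox A

-- The □-interpretation.  `hat k i` names the QS4 predicate variable
-- α̂ = mpred k (inj₂ (hat k i)) assigned to the problem variable α^k_i
-- (same arity; disjoint from the proper ones by construction).

Hat : Set
Hat = ℕ → ℕ → ℕ

HatInjective : Hat → Set
HatInjective hat = ∀ k i j → hat k i ≡ hat k j → i ≡ j

mutual
  trC : Hat → CForm → MForm
  trC h ctop = mtop
  trC h cbot = mbot
  trC h (cpred k i xs) = mpred k (inj₁ i) xs
  trC h (cq Φ) = trI h Φ
  trC h (cand A B) = mand (trC h A) (trC h B)
  trC h (cor A B) = mor (trC h A) (trC h B)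
  trC h (cimp A B) = mimp (trC h A) (trC h B)
  trC h (ciff A B) = miff (trC h A) (trC h B)
  trC h (cneg A) = mneg (trC h A)
  trC h (cex A) = mex (trC h A)
  trC h (call A) = mall (trC h A)

  trI : Hat → IForm → MForm
  trI h itriv = mtop
  trI h iabs = mbot
  trI h (iprob k i xs) = mbox (mpred k (inj₂ (h k i)) xs)
  trI h (ibang F) = mbox (trC h F)
  trI h (iand A B) = mbox (mand (trI h A) (trI h B))
  trI h (ior A B) = mbox (mor (trI h A) (trI h B))
  trI h (iimp A B) = mbox (mimp (trI h A) (trI h B))
  trI h (iiff A B) = mbox (miff (trI h A) (trI h B))
  trI h (ineg A) = mbox (mneg (trI h A))
  trI h (iex A) = mbox (mex (trI h A))
  trI h (iall A) = mbox (mall (trI h A))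

trF : Hat → Fm → MForm
trF h (inj₁ F) = trC h F
trF h (inj₂ Φ) = trI h Φ

-- Every translated i-formula is stable: it is ⊤, ⊥ or a boxed formula, so it
-- provably implies its own box.  From stable hypotheses S4 can box a whole
-- derivation (box the implication given by the deduction theorem, then use K
-- and stability), which makes the boxed implications (Φ → Ψ)□ behave like
-- intuitionistic implications: the QH axioms, the QHC principles and the rules
-- all become derivable in QS4, with T undoing boxes where QHC applies modus
-- ponens or !p/p, and necessitation interpreting p/!p.
module Submission where

open import Data.List using (List; []; _∷_; map)
open import Data.List.Membership.Propositional using (_∈_)
open import Data.List.Membership.Propositional.Properties using (∈-map⁺)
open import Data.List.Relation.Binary.Subset.Propositional using (_⊆_)
import Data.List.Relation.Binary.Subset.Propositional.Properties as ⊆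
open import Data.List.Relation.Unary.All using (All; []; _∷_)
open import Data.List.Relation.Unary.Any using (here; there)
open import Data.Nat using (zero; suc)
open import Data.Sum using (inj₁; inj₂)
import Data.Vec as Vec
import Data.Vec.Properties as Vec
open import Relation.Binary.PropositionalEquality
  using (_≡_; refl; sym; cong; cong₂; subst; module ≡-Reasoning)

open import Defs

liftR-retraction : ∀ {ρ σ} → (∀ i → ρ (σ i) ≡ i) → ∀ i → liftR ρ (liftR σ i) ≡ i
liftR-retraction e zero    = refl
liftR-retraction e (suc i) = cong suc (e i)

renM-retraction : ∀ {ρ σ} → (∀ i → ρ (σ i) ≡ i) → ∀ A → renM ρ (renM σ A) ≡ A
renM-retraction e mtop = refl
renM-retraction e mbot = refl
renM-retraction {ρ} {σ} e (mpred k v xs) = cong (mpred k v) (begin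
  Vec.map ρ (Vec.map σ xs)     ≡⟨ Vec.map-∘ ρ σ xs ⟨
  Vec.map (λ i → ρ (σ i)) xs   ≡⟨ Vec.map-cong e xs ⟩
  Vec.map (λ i → i) xs         ≡⟨ Vec.map-id xs ⟩
  xs                           ∎)
  where open ≡-Reasoning
renM-retraction e (mand A B) = cong₂ mand (renM-retraction e A) (renM-retraction e B)
renM-retraction e (mor A B)  = cong₂ mor (renM-retraction e A) (renM-retraction e B)
renM-retraction e (mimp A B) = cong₂ mimp (renM-retraction e A) (renM-retraction e B)
renM-retraction e (miff A B) = cong₂ miff (renM-retraction e A) (renM-retraction e B)
renM-retraction e (mneg A)   = cong mneg (renM-retraction e A)
renM-retraction e (mex A)    = cong mex (renM-retraction (liftR-retraction e) A)
renM-retraction e (mall A)   = cong mall (renM-retraction (liftR-retraction e) A)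
renM-retraction e (mbox A)   = cong mbox (renM-retraction e A)

renM-inst₀-liftR-suc : ∀ A → renM (inst₀ 0) (renM (liftR suc) A) ≡ A
renM-inst₀-liftR-suc = renM-retraction inst₀-suc
  where
  inst₀-suc : ∀ i → inst₀ 0 (liftR suc i) ≡ i
  inst₀-suc zero    = refl
  inst₀-suc (suc i) = refl

module _ (hat : Hat) where

  mutual
    trC-ren : ∀ ρ F → trC hat (renC ρ F) ≡ renM ρ (trC hat F)
    trC-ren ρ ctop = refl
    trC-ren ρ cbot = refl
    trC-ren ρ (cpred k i xs) = refl
    trC-ren ρ (cq Φ)     = trI-ren ρ Φ
    trC-ren ρ (cand A B) = cong₂ mand (trC-ren ρ A) (trC-ren ρ B)
    trC-ren ρ (cor A B)  = cong₂ mor (trC-ren ρ A) (trC-ren ρ B)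
    trC-ren ρ (cimp A B) = cong₂ mimp (trC-ren ρ A) (trC-ren ρ B)
    trC-ren ρ (ciff A B) = cong₂ miff (trC-ren ρ A) (trC-ren ρ B)
    trC-ren ρ (cneg A)   = cong mneg (trC-ren ρ A)
    trC-ren ρ (cex A)    = cong mex (trC-ren (liftR ρ) A)
    trC-ren ρ (call A)   = cong mall (trC-ren (liftR ρ) A)

    trI-ren : ∀ ρ Φ → trI hat (renI ρ Φ) ≡ renM ρ (trI hat Φ)
    trI-ren ρ itriv = refl
    trI-ren ρ iabs  = refl
    trI-ren ρ (iprob k i xs) = refl
    trI-ren ρ (ibang F)  = cong mbox (trC-ren ρ F)
    trI-ren ρ (iand A B) = cong mbox (cong₂ mand (trI-ren ρ A) (trI-ren ρ B))
    trI-ren ρ (ior A B)  = cong mbox (cong₂ mor (trI-ren ρ A) (trI-ren ρ B))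
    trI-ren ρ (iimp A B) = cong mbox (cong₂ mimp (trI-ren ρ A) (trI-ren ρ B))
    trI-ren ρ (iiff A B) = cong mbox (cong₂ miff (trI-ren ρ A) (trI-ren ρ B))
    trI-ren ρ (ineg A)   = cong mbox (cong mneg (trI-ren ρ A))
    trI-ren ρ (iex A)    = cong mbox (cong mex (trI-ren (liftR ρ) A))
    trI-ren ρ (iall A)   = cong mbox (cong mall (trI-ren (liftR ρ) A))

  trF-ren : ∀ ρ A → trF hat (renF ρ A) ≡ renM ρ (trF hat A)
  trF-ren ρ (inj₁ F) = trC-ren ρ F
  trF-ren ρ (inj₂ Φ) = trI-ren ρ Φ

  map-trF-renF : ∀ ρ Γ → map (trF hat) (map (renF ρ) Γ) ≡ map (renM ρ) (map (trF hat) Γ)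
  map-trF-renF ρ []      = refl
  map-trF-renF ρ (A ∷ Γ) = cong₂ _∷_ (trF-ren ρ A) (map-trF-renF ρ Γ)

⊢QS4-weaken : ∀ {Γ Δ A} → Γ ⊆ Δ → Γ ⊢QS4 A → Δ ⊢QS4 A
⊢QS4-weaken s (hyp m)  = hyp (s m)
⊢QS4-weaken s (ax a)   = ax a
⊢QS4-weaken s (mp d e) = mp (⊢QS4-weaken s d) (⊢QS4-weaken s e)
⊢QS4-weaken s (gen d)  = gen (⊢QS4-weaken (⊆.map⁺ (renM suc) s) d)
⊢QS4-weaken s (nec d)  = nec (⊢QS4-weaken s d)

-- QS4 derivations in which necessitation is applied only to theorems, never to
-- hypotheses; for these the deduction theorem holds.
infix 4 _⊢_
data _⊢_ : List MForm → MForm → Set where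
  hyp : ∀ {Γ A} → A ∈ Γ → Γ ⊢ A
  ax  : ∀ {Γ A} → MAx A → Γ ⊢ A
  mp  : ∀ {Γ A B} → Γ ⊢ mimp A B → Γ ⊢ A → Γ ⊢ B
  gen : ∀ {Γ A} → map (renM suc) Γ ⊢ A → Γ ⊢ mall A
  thm : ∀ {Γ A} → [] ⊢QS4 A → Γ ⊢ A

⊢⇒⊢QS4 : ∀ {Γ A} → Γ ⊢ A → Γ ⊢QS4 A
⊢⇒⊢QS4 (hyp m)  = hyp m
⊢⇒⊢QS4 (ax a)   = ax a
⊢⇒⊢QS4 (mp d e) = mp (⊢⇒⊢QS4 d) (⊢⇒⊢QS4 e)
⊢⇒⊢QS4 (gen d)  = gen (⊢⇒⊢QS4 d)
⊢⇒⊢QS4 (thm p)  = ⊢QS4-weaken (λ ()) p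

⊢-weaken : ∀ {Γ Δ A} → Γ ⊆ Δ → Γ ⊢ A → Δ ⊢ A
⊢-weaken s (hyp m)  = hyp (s m)
⊢-weaken s (ax a)   = ax a
⊢-weaken s (mp d e) = mp (⊢-weaken s d) (⊢-weaken s e)
⊢-weaken s (gen d)  = gen (⊢-weaken (⊆.map⁺ (renM suc) s) d)
⊢-weaken s (thm p)  = thm p

⊢-closed : ∀ {Γ A} → [] ⊢ A → Γ ⊢ A
⊢-closed d = thm (⊢⇒⊢QS4 d)

var₀ : ∀ {A Γ} → A ∷ Γ ⊢ A
var₀ = hyp (here refl)

var₁ : ∀ {A B Γ} → B ∷ A ∷ Γ ⊢ A
var₁ = hyp (there (here refl))

var₂ : ∀ {A B C Γ} → C ∷ B ∷ A ∷ Γ ⊢ A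
var₂ = hyp (there (there (here refl)))

⊢-imp-refl : ∀ {Γ A} → Γ ⊢ mimp A A
⊢-imp-refl {A = A} = mp (mp (ax (s-ax A (mimp A A) A)) (ax (k-ax A (mimp A A)))) (ax (k-ax A A))

deduction : ∀ {Γ A B} → A ∷ Γ ⊢ B → Γ ⊢ mimp A B
deduction (hyp (here refl)) = ⊢-imp-refl
deduction (hyp (there m))   = mp (ax (k-ax _ _)) (hyp m)
deduction (ax a)            = mp (ax (k-ax _ _)) (ax a)
deduction (thm p)           = mp (ax (k-ax _ _)) (thm p)
deduction (mp d e)          = mp (mp (ax (s-ax _ _ _)) (deduction d)) (deduction e)
deduction (gen {A = B} d)   = mp (ax (allI _ B)) (gen (deduction d))

∀-elim₀ : ∀ {Γ} A → Γ ⊢ mall (renM (liftR suc) A) → Γ ⊢ A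
∀-elim₀ {Γ} A d = subst (Γ ⊢_) (renM-inst₀-liftR-suc A) (mp (ax (allE _ 0)) d)

∃-intro₀ : ∀ {Γ} A → Γ ⊢ A → Γ ⊢ mex (renM (liftR suc) A)
∃-intro₀ {Γ} A d = mp (ax (exI _ 0)) (subst (Γ ⊢_) (sym (renM-inst₀-liftR-suc A)) d)

□-elim : ∀ {Γ A} → Γ ⊢ mbox A → Γ ⊢ A
□-elim d = mp (ax (box-T _)) d

□-mp : ∀ {Γ A B} → Γ ⊢ mbox (mimp A B) → Γ ⊢ mbox A → Γ ⊢ mbox B
□-mp f x = mp (mp (ax (box-K _ _)) f) x

□-strict-mp : ∀ {Γ A B} → Γ ⊢ mbox (mimp A B) → Γ ⊢ A → Γ ⊢ B
□-strict-mp f x = mp (□-elim f) x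

nec-closed : ∀ {Γ A} → [] ⊢ A → Γ ⊢ mbox A
nec-closed d = thm (nec (⊢⇒⊢QS4 d))

Stable : MForm → Set
Stable A = [] ⊢ mimp A (mbox A)

□-stable : ∀ {A} → Stable (mbox A)
□-stable = ax (box-4 _)

nec-stable : ∀ {Δ A} → All Stable Δ → Δ ⊢ A → Δ ⊢ mbox A
nec-stable []       d = nec-closed d
nec-stable (s ∷ st) d =
  □-mp (⊢-weaken there (nec-stable st (deduction d))) (mp (⊢-closed s) var₀)

□-deduction : ∀ {Δ A B} → All Stable Δ → A ∷ Δ ⊢ B → Δ ⊢ mbox (mimp A B)
□-deduction st d = nec-stable st (deduction d)

module Interpretation (hat : Hat) where

  trI-stable : ∀ Φ → Stable (trI hat Φ)
  trI-stable itriv          = deduction (nec-closed (ax topI))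
  trI-stable iabs           = ax (botE _)
  trI-stable (iprob k i xs) = □-stable
  trI-stable (ibang F)      = □-stable
  trI-stable (iand A B)     = □-stable
  trI-stable (ior A B)      = □-stable
  trI-stable (iimp A B)     = □-stable
  trI-stable (iiff A B)     = □-stable
  trI-stable (ineg A)       = □-stable
  trI-stable (iex A)        = □-stable
  trI-stable (iall A)       = □-stable

  trI-box : ∀ {Γ} Φ → Γ ⊢ trI hat Φ → Γ ⊢ mbox (trI hat Φ)
  trI-box Φ d = mp (⊢-closed (trI-stable Φ)) d

  trC-CAx : ∀ {F} → CAx F → MAx (trC hat F)
  trC-CAx (k-ax A B)   = k-ax _ _
  trC-CAx (s-ax A B C) = s-ax _ _ _
  trC-CAx (andI A B)   = andI _ _
  trC-CAx (andE₁ A B)  = andE₁ _ _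
  trC-CAx (andE₂ A B)  = andE₂ _ _
  trC-CAx (orI₁ A B)   = orI₁ _ _
  trC-CAx (orI₂ A B)   = orI₂ _ _
  trC-CAx (orE A B C)  = orE _ _ _
  trC-CAx (botE A)     = botE _
  trC-CAx topI         = topI
  trC-CAx (iffE₁ A B)  = iffE₁ _ _
  trC-CAx (iffE₂ A B)  = iffE₂ _ _
  trC-CAx (iffI A B)   = iffI _ _
  trC-CAx (negE A)     = negE _
  trC-CAx (negI A)     = negI _
  trC-CAx (dne A)      = dne _
  trC-CAx (allE A t) rewrite trC-ren hat (inst₀ t) A = allE _ t
  trC-CAx (exI A t)  rewrite trC-ren hat (inst₀ t) A = exI _ t
  trC-CAx (allI B A) rewrite trC-ren hat suc B = allI _ _
  trC-CAx (exE A B)  rewrite trC-ren hat suc B = exE _ _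

  trI-IAx : ∀ {Φ} → IAx Φ → [] ⊢ trI hat Φ
  trI-IAx (k-ax A B) = □-deduction [] (□-deduction (trI-stable A ∷ []) var₁)
  trI-IAx (s-ax A B C) =
    □-deduction [] (□-deduction (trI-stable (iimp A (iimp B C)) ∷ [])
      (□-deduction (trI-stable (iimp A B) ∷ trI-stable (iimp A (iimp B C)) ∷ [])
        (□-strict-mp (□-strict-mp var₂ var₀) (□-strict-mp var₁ var₀))))
  trI-IAx (andI A B) =
    □-deduction [] (□-deduction (trI-stable A ∷ [])
      (nec-stable (trI-stable B ∷ trI-stable A ∷ []) (mp (mp (ax (andI _ _)) var₁) var₀)))
  trI-IAx (andE₁ A B) = □-deduction [] (mp (ax (andE₁ _ _)) (□-elim var₀))
  trI-IAx (andE₂ A B) = □-deduction [] (mp (ax (andE₂ _ _)) (□-elim var₀))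
  trI-IAx (orI₁ A B) = □-deduction [] (nec-stable (trI-stable A ∷ []) (mp (ax (orI₁ _ _)) var₀))
  trI-IAx (orI₂ A B) = □-deduction [] (nec-stable (trI-stable B ∷ []) (mp (ax (orI₂ _ _)) var₀))
  trI-IAx (orE A B C) =
    □-deduction [] (□-deduction (trI-stable (iimp A C) ∷ [])
      (□-deduction (trI-stable (iimp B C) ∷ trI-stable (iimp A C) ∷ [])
        (mp (mp (mp (ax (orE _ _ _)) (□-elim var₂)) (□-elim var₁)) (□-elim var₀))))
  trI-IAx (botE A) = □-deduction [] (mp (ax (botE _)) var₀)
  trI-IAx topI = ax topI
  trI-IAx (iffE₁ A B) =
    □-deduction [] (nec-stable (trI-stable (iiff A B) ∷ []) (mp (ax (iffE₁ _ _)) (□-elim var₀)))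
  trI-IAx (iffE₂ A B) =
    □-deduction [] (nec-stable (trI-stable (iiff A B) ∷ []) (mp (ax (iffE₂ _ _)) (□-elim var₀)))
  trI-IAx (iffI A B) =
    □-deduction [] (□-deduction (trI-stable (iimp A B) ∷ [])
      (nec-stable (trI-stable (iimp B A) ∷ trI-stable (iimp A B) ∷ [])
        (mp (mp (ax (iffI _ _)) (□-elim var₁)) (□-elim var₀))))
  trI-IAx (negE A) =
    □-deduction [] (□-deduction (trI-stable (ineg A) ∷ []) (mp (mp (ax (negE _)) (□-elim var₁)) var₀))
  trI-IAx (negI A) =
    □-deduction [] (nec-stable (trI-stable (iimp A iabs) ∷ []) (mp (ax (negI _)) (□-elim var₀)))
  trI-IAx (allE A t) =
    □-deduction [] (subst (_ ⊢_) (sym (trI-ren hat (inst₀ t) A))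
      (mp (ax (allE _ t)) (□-elim var₀)))
  trI-IAx (exI A t) =
    □-deduction [] (nec-stable (trI-stable (renI (inst₀ t) A) ∷ [])
      (mp (ax (subst (λ X → MAx (mimp X (mex (trI hat A)))) (sym (trI-ren hat (inst₀ t) A)) (exI _ t)))
        var₀))
  trI-IAx (allI B A) rewrite trI-ren hat suc B =
    □-deduction [] (□-deduction (□-stable ∷ []) (nec-stable (trI-stable B ∷ □-stable ∷ [])
      (gen (□-strict-mp (∀-elim₀ (mbox (mimp (renM suc (trI hat B)) (trI hat A))) (□-elim var₁)) var₀))))
  trI-IAx (exE A B) rewrite trI-ren hat suc B =
    □-deduction [] (□-deduction (□-stable ∷ []) (mp (mp (ax (exE _ _))
      (gen (□-elim (∀-elim₀ (mbox (mimp (trI hat A) (renM suc (trI hat B)))) (□-elim var₁)))))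
      (□-elim var₀)))

  trC-HCAx : ∀ {F} → HCAx F → [] ⊢ trC hat F
  trC-HCAx (q-and γ δ) =
    mp (mp (ax (iffI _ _)) (deduction (□-elim var₀)))
      (deduction (□-mp (□-mp (nec-closed (deduction (deduction (mp (mp (ax (andI _ _)) var₁) var₀))))
        (trI-box γ (mp (ax (andE₁ _ _)) var₀))) (trI-box δ (mp (ax (andE₂ _ _)) var₀))))
  trC-HCAx (q-or γ δ) =
    mp (mp (ax (iffI _ _)) (deduction (□-elim var₀)))
      (deduction (mp (mp (mp (ax (orE _ _ _))
        (deduction (□-mp (nec-closed (ax (orI₁ _ _))) (trI-box γ var₀))))
        (deduction (□-mp (nec-closed (ax (orI₂ _ _))) (trI-box δ var₀)))) var₀))
  trC-HCAx (q-imp γ δ) = ax (box-T _)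
  trC-HCAx q-abs       = mp (ax (negI _)) ⊢-imp-refl
  trC-HCAx (q-ex θ) =
    mp (mp (ax (iffI _ _)) (ax (box-T _)))
      (mp (ax (exE _ _)) (gen (deduction (nec-stable (trI-stable θ ∷ []) (∃-intro₀ (trI hat θ) var₀)))))
  trC-HCAx (q-all θ)   = ax (box-T _)
  trC-HCAx (q-bang p)  = ax (box-T _)

  trI-HIAx : ∀ {Φ} → HIAx Φ → [] ⊢ trI hat Φ
  trI-HIAx (unit γ)     = nec-closed (trI-stable γ)
  trI-HIAx bang-bot     = nec-closed (mp (ax (negI _)) (ax (box-T mbot)))
  trI-HIAx (bang-4 p)   = nec-closed □-stable
  trI-HIAx (bang-K p q) = □-deduction [] (nec-stable (□-stable ∷ []) (deduction (□-mp var₁ var₀)))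

  sound : ∀ {Γ A} → Γ ⊢QHC A → map (trF hat) Γ ⊢QS4 trF hat A
  sound (hyp m)   = hyp (∈-map⁺ (trF hat) m)
  sound (cax a)   = ax (trC-CAx a)
  sound (iax a)   = ⊢⇒⊢QS4 (⊢-closed (trI-IAx a))
  sound (hcax a)  = ⊢⇒⊢QS4 (⊢-closed (trC-HCAx a))
  sound (hiax a)  = ⊢⇒⊢QS4 (⊢-closed (trI-HIAx a))
  sound (cmp d e) = mp (sound d) (sound e)
  sound (imp d e) = mp (mp (ax (box-T _)) (sound d)) (sound e)
  sound {Γ} (cgen d) = gen (subst (_⊢QS4 _) (map-trF-renF hat suc Γ) (sound d))
  sound {Γ} (igen d) = nec (gen (subst (_⊢QS4 _) (map-trF-renF hat suc Γ) (sound d)))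
  sound (bangE d) = mp (ax (box-T _)) (sound d)
  sound (bangI d) = nec (sound d)

mainTheorem1 : (hat : Hat) → HatInjective hat →
    (Γ : List Fm) (A : Fm) → Γ ⊢QHC A → map (trF hat) Γ ⊢QS4 trF hat A
mainTheorem1 hat _ Γ A = Interpretation.sound hat
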